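{- For any bound $k \in \mathbb{N}$ and finite sets of atomic propositions $\mathit{AP}$ and $I$ with $\emptyset \neq I \subseteq \mathit{AP}$, every nondeterministic finite automaton over the alphabet $\Sigma = 2^{\mathit{AP}}$ that recognizes $L = \{ w \in \Sigma^* \mid \exists \sigma \in L_k^I(\Sigma^\omega).\ w \text{ is a prefix of } \sigma\}$ has at least $2^{\Omega(k)}$ states.
   Context: For $\sigma \in \Sigma^\omega$, $\sigma|_I \in (2^I)^\omega$ is its projection onto $I$. $L_k^I(\Sigma^\omega)$ is the set of all $\sigma \in \Sigma^\omega$ for which there exist finite words $u \in (2^I)^*$ and $v \in (2^I)^+$ with $|u \cdot v| = k$ and $\sigma|_I = u \cdot v^\omega$. -}

module Defs where

open import Data.Nat using (ℕ; zero; suc; _+_; _<_)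
open import Data.Nat.DivMod using (_mod_)
open import Data.Fin using (Fin)
open import Data.Fin.Subset using (Subset; _⊆_; _∩_)
open import Data.List using (List; []; _∷_; length; lookup)
open import Data.List.Relation.Unary.All using (All)
open import Data.Bool using (Bool; true)
open import Data.Unit using (⊤)
open import Data.Product using (Σ; ∃; _×_)
open import Relation.Binary.PropositionalEquality using (_≡_)

-- Atomic propositions AP = Fin m; alphabet Σ = 2^AP = Subset m.
Letter : ℕ → Set
Letter m = Subset m

ωWord : ℕ → Set
ωWord m = ℕ → Letter m

-- The ω-word  u · v^ω  where v = v₀ ∷ vs is nonempty.
cyclic : ∀ {A : Set} → A → List A → ℕ → A
cyclic v₀ vs n = lookup (v₀ ∷ vs) (n mod suc (length vs))

lasso : ∀ {A : Set} → List A → A → List A → ℕ → A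
lasso [] v₀ vs n = cyclic v₀ vs n
lasso (x ∷ u) v₀ vs zero = x
lasso (x ∷ u) v₀ vs (suc n) = lasso u v₀ vs n

-- Projection onto I: a letter a ∈ 2^AP is mapped to a ∩ I ∈ 2^I
-- (2^I identified with the subsets of AP contained in I).
project : ∀ {m} → Subset m → ωWord m → ωWord m
project I σ n = σ n ∩ I

InLkI : ∀ {m} → ℕ → Subset m → ωWord m → Set
InLkI {m} k I σ =
  Σ (List (Subset m)) λ u → Σ (Subset m) λ v₀ → Σ (List (Subset m)) λ vs →
    All (_⊆ I) u × All (_⊆ I) (v₀ ∷ vs) ×
    (length u + length (v₀ ∷ vs) ≡ k) ×
    (∀ n → project I σ n ≡ lasso u v₀ vs n)

IsPrefix : ∀ {A : Set} → List A → (ℕ → A) → Set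
IsPrefix [] σ = ⊤
IsPrefix (a ∷ w) σ = (a ≡ σ 0) × IsPrefix w (λ n → σ (suc n))

PrefLang : ∀ {m} → ℕ → Subset m → List (Letter m) → Set
PrefLang {m} k I w = Σ (ωWord m) λ σ → InLkI k I σ × IsPrefix w σ

record NFA (A : Set) : Set where
  field
    n       : ℕ
    initial : Fin n → Bool
    δ       : Fin n → A → Fin n → Bool
    final   : Fin n → Bool

module _ {A : Set} (M : NFA A) where
  open NFA M
  data Run : Fin n → List A → Fin n → Set where
    done : ∀ {q} → Run q [] q
    step : ∀ {q a w q' q''} → δ q a q' ≡ true → Run q' w q'' → Run q (a ∷ w) q''

  Accepts : List A → Set
  Accepts w = Σ (Fin n) λ q₀ → Σ (Fin n) λ q_f →
    (initial q₀ ≡ true) × (final q_f ≡ true) × Run q₀ w q_f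

Recognizes : ∀ {A : Set} → NFA A → (List A → Set) → Set
Recognizes {A} M L = ∀ (w : List A) → (Accepts M w → L w) × (L w → Accepts M w)

-- Fooling-set argument. Split k = (i + 1) + (i + 1 + e) and fix two distinct letters a, b ⊆ I.
-- To a bit string f of length i attach the block code f = f₀ … f_{i-1} b a a …, and take
-- x_f = its first k letters (one period) and y_f = its first i + 1 letters. Then x_f y_f is a
-- prefix of the purely periodic word (x_f)^ω, which lies in L_k^I. Conversely, if x_f y_g is a
-- prefix of some σ with σ|_I = u v^ω, |u v| = k: when u is empty the period is k and the second
-- block repeats the first, so g = f; otherwise the letter b at position k + i is repeated one
-- period earlier inside the a-zone of x_f. Hence the 2^i states reached after the words x_f in
-- accepting runs are pairwise distinct, and since i ≥ k/5 for k ≥ 4, 2^k ≤ n^5.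
module Submission where

open import Defs
open import Data.Nat using (ℕ; _≤_; _^_)
open import Data.Fin.Subset using (Subset; Nonempty)
open import Data.Product using (∃-syntax; _×_)

open import Data.Nat using (zero; suc; _+_; _*_; _<_; _%_; z≤n; s≤s; _<?_)
open import Data.Nat.Properties
open import Data.Nat.DivMod using (_mod_; m%n%n≡m%n; [m+n]%n≡m%n; m%n<n; m<n⇒m%n≡m)
open import Data.Fin as Fin using (Fin; toℕ; finToFun; funToFin; combine)
open import Data.Fin.Properties using (fromℕ<-cong; toℕ-fromℕ<; toℕ<n; injective⇒≤; funToFin-finToFin)
open import Data.Fin.Subset using (_∩_; _⊆_; _∈_; ⊥)
open import Data.Fin.Subset.Properties using (p∩q⊆q; ∉⊥; ∩-zeroˡ; ∩-idem)
open import Data.List using (List; []; _∷_; _++_; length; lookup; applyUpTo)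
open import Data.List.Properties using (length-applyUpTo; lookup-applyUpTo)
open import Data.List.Relation.Unary.All using ([])
open import Data.List.Relation.Unary.All.Properties using (applyUpTo⁺₂)
open import Data.Product using (_,_; proj₁; proj₂)
open import Data.Bool using (true)
open import Data.Unit using (tt)
open import Data.Empty using (⊥-elim)
open import Function using (_∘_)
open import Relation.Nullary using (yes; no; contradiction)
open import Relation.Binary.PropositionalEquality

IsPrefix-applyUpTo⁺ : ∀ {A : Set} (g σ : ℕ → A) K →
                      (∀ n → n < K → g n ≡ σ n) → IsPrefix (applyUpTo g K) σ
IsPrefix-applyUpTo⁺ g σ zero    agree = tt
IsPrefix-applyUpTo⁺ g σ (suc K) agree =
  agree 0 (s≤s z≤n) , IsPrefix-applyUpTo⁺ (g ∘ suc) (σ ∘ suc) K (λ n → agree (suc n) ∘ s≤s)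

IsPrefix-applyUpTo⁻ : ∀ {A : Set} (g σ : ℕ → A) K →
                      IsPrefix (applyUpTo g K) σ → ∀ n → n < K → g n ≡ σ n
IsPrefix-applyUpTo⁻ g σ (suc K) (g₀≡σ₀ , _) zero    _         = g₀≡σ₀
IsPrefix-applyUpTo⁻ g σ (suc K) (_ , prefix) (suc n) (s≤s n<K) =
  IsPrefix-applyUpTo⁻ (g ∘ suc) (σ ∘ suc) K prefix n n<K

IsPrefix-applyUpTo-++⁺ : ∀ {A : Set} (g σ : ℕ → A) K (ys : List A) →
                         (∀ n → n < K → g n ≡ σ n) → IsPrefix ys (λ t → σ (K + t)) →
                         IsPrefix (applyUpTo g K ++ ys) σ
IsPrefix-applyUpTo-++⁺ g σ zero    ys agree prefix = prefix
IsPrefix-applyUpTo-++⁺ g σ (suc K) ys agree prefix =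
  agree 0 (s≤s z≤n) ,
  IsPrefix-applyUpTo-++⁺ (g ∘ suc) (σ ∘ suc) K ys (λ n → agree (suc n) ∘ s≤s) prefix

IsPrefix-applyUpTo-++⁻ : ∀ {A : Set} (g σ : ℕ → A) K (ys : List A) →
                         IsPrefix (applyUpTo g K ++ ys) σ →
                         (∀ n → n < K → g n ≡ σ n) × IsPrefix ys (λ t → σ (K + t))
IsPrefix-applyUpTo-++⁻ g σ zero    ys prefix = (λ _ ()) , prefix
IsPrefix-applyUpTo-++⁻ g σ (suc K) ys (g₀≡σ₀ , prefix)
  with IsPrefix-applyUpTo-++⁻ (g ∘ suc) (σ ∘ suc) K ys prefix
... | agree , rest = agreeₛ , rest
  where
  agreeₛ : ∀ n → n < suc K → g n ≡ σ n
  agreeₛ zero    _         = g₀≡σ₀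
  agreeₛ (suc n) (s≤s n<K) = agree n n<K

cyclic-cong : ∀ {A : Set} (v₀ : A) vs {n n′} →
              n % length (v₀ ∷ vs) ≡ n′ % length (v₀ ∷ vs) → cyclic v₀ vs n ≡ cyclic v₀ vs n′
cyclic-cong v₀ vs eq = cong (lookup (v₀ ∷ vs)) (fromℕ<-cong _ _ eq _ _)

cyclic-applyUpTo : ∀ {A : Set} (g : ℕ → A) K n →
                   cyclic (g 0) (applyUpTo (g ∘ suc) K) n ≡ g (n % suc K)
cyclic-applyUpTo g K n = begin
  cyclic (g 0) vs n                    ≡⟨ lookup-applyUpTo g (suc K) (n mod suc (length vs)) ⟩
  g (toℕ (n mod suc (length vs)))      ≡⟨ cong g (toℕ-fromℕ< _) ⟩
  g (n % suc (length vs))              ≡⟨ cong (λ l → g (n % suc l)) (length-applyUpTo (g ∘ suc) K) ⟩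
  g (n % suc K)                        ∎
  where
  open ≡-Reasoning
  vs = applyUpTo (g ∘ suc) K

lasso-shift : ∀ {A : Set} (u : List A) v₀ vs n → lasso u v₀ vs (length u + n) ≡ cyclic v₀ vs n
lasso-shift []      v₀ vs n = refl
lasso-shift (_ ∷ u) v₀ vs n = lasso-shift u v₀ vs n

lasso-wrap : ∀ {A : Set} (u : List A) v₀ vs {K} → length u + length (v₀ ∷ vs) ≡ K →
             ∀ t → lasso u v₀ vs (K + t) ≡ lasso u v₀ vs (length u + t % length (v₀ ∷ vs))
lasso-wrap u v₀ vs refl t = begin
  lasso u v₀ vs (U + P + t)    ≡⟨ cong (lasso u v₀ vs) (+-assoc U P t) ⟩
  lasso u v₀ vs (U + (P + t))  ≡⟨ lasso-shift u v₀ vs (P + t) ⟩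
  cyclic v₀ vs (P + t)         ≡⟨ cyclic-cong v₀ vs {P + t} {t % P} P+t≡t ⟩
  cyclic v₀ vs (t % P)         ≡⟨ lasso-shift u v₀ vs (t % P) ⟨
  lasso u v₀ vs (U + t % P)    ∎
  where
  open ≡-Reasoning
  U = length u
  P = length (v₀ ∷ vs)
  P+t≡t : (P + t) % P ≡ t % P % P
  P+t≡t = trans (cong (_% P) (+-comm P t)) (trans ([m+n]%n≡m%n t P) (sym (m%n%n≡m%n t P)))

module _ {A : Set} (M : NFA A) where
  open NFA M

  Reaches : List A → Fin n → Set
  Reaches w q = ∃[ q₀ ] (initial q₀ ≡ true × Run M q₀ w q)

  Completes : Fin n → List A → Set
  Completes q w = ∃[ q_f ] (final q_f ≡ true × Run M q w q_f)

  Run-++⁻ : ∀ {q q″} (xs : List A) {ys} → Run M q (xs ++ ys) q″ → ∃[ q′ ] (Run M q xs q′ × Run M q′ ys q″)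
  Run-++⁻ []       run         = _ , done , run
  Run-++⁻ (_ ∷ xs) (step δ run) with Run-++⁻ xs run
  ... | q′ , run₁ , run₂ = q′ , step δ run₁ , run₂

  Run-++⁺ : ∀ {q q′ q″} {xs ys : List A} → Run M q xs q′ → Run M q′ ys q″ → Run M q (xs ++ ys) q″
  Run-++⁺ done           run₂ = run₂
  Run-++⁺ (step δ run₁) run₂ = step δ (Run-++⁺ run₁ run₂)

  Accepts-++⁻ : ∀ (xs : List A) {ys} → Accepts M (xs ++ ys) → ∃[ q ] (Reaches xs q × Completes q ys)
  Accepts-++⁻ xs (q₀ , q_f , init , fin , run) with Run-++⁻ xs run
  ... | q , run₁ , run₂ = q , (q₀ , init , run₁) , (q_f , fin , run₂)

  Accepts-++⁺ : ∀ {xs ys : List A} {q} → Reaches xs q → Completes q ys → Accepts M (xs ++ ys)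
  Accepts-++⁺ (q₀ , init , run₁) (q_f , fin , run₂) = q₀ , q_f , init , fin , Run-++⁺ run₁ run₂

  fooling-set-bound : ∀ {N} {L : List A → Set} → Recognizes M L → (x y : Fin N → List A) →
                      (∀ z → L (x z ++ y z)) → (∀ z z′ → L (x z ++ y z′) → z ≡ z′) → N ≤ n
  fooling-set-bound recognizes x y diagonal off-diagonal = injective⇒≤ middle-injective
    where
    split : ∀ z → ∃[ q ] (Reaches (x z) q × Completes q (y z))
    split z = Accepts-++⁻ (x z) (proj₂ (recognizes _) (diagonal z))

    middle : Fin _ → Fin n
    middle z = proj₁ (split z)

    middle-injective : ∀ {z z′} → middle z ≡ middle z′ → z ≡ z′
    middle-injective {z} {z′} eq = off-diagonal z z′ (proj₁ (recognizes _) (Accepts-++⁺ reaches completes))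
      where
      reaches : Reaches (x z) (middle z′)
      reaches = subst (Reaches (x z)) eq (proj₁ (proj₂ (split z)))
      completes : Completes (middle z′) (y z′)
      completes = proj₂ (proj₂ (split z′))

funToFin-cong : ∀ {a b} {f g : Fin a → Fin b} → f ≗ g → funToFin f ≡ funToFin g
funToFin-cong {zero}  f≗g = refl
funToFin-cong {suc a} f≗g = cong₂ combine (f≗g Fin.zero) (funToFin-cong (f≗g ∘ Fin.suc))

finToFun-injective : ∀ {a b} {z z′ : Fin (b ^ a)} → finToFun {b} {a} z ≗ finToFun z′ → z ≡ z′
finToFun-injective {a} {b} {z} {z′} eq = begin
  z                              ≡⟨ funToFin-finToFin {a} {b} z ⟨
  funToFin (finToFun {b} {a} z)  ≡⟨ funToFin-cong {a} {b} eq ⟩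
  funToFin (finToFun {b} {a} z′) ≡⟨ funToFin-finToFin {a} {b} z′ ⟩
  z′                             ∎
  where open ≡-Reasoning

-- When u is nonempty, lasso-wrap sends position k + i to U + i % P, which lies past the block
-- f₀ … f_{i-1} b, i.e. in the a-zone of x_f.
wrap-position-after-block : ∀ U p i e → 1 ≤ U → U + suc p ≡ suc i + (suc i + e) → i < U + i % suc p
wrap-position-after-block U p i e 1≤U U+P≡k with i <? U
... | yes i<U = <-≤-trans i<U (m≤m+n U _)
... | no  i≮U = subst (λ r → i < U + r) (sym (m<n⇒m%n≡m i<P)) (+-monoˡ-≤ i 1≤U)
  where
  i+i<k : i + i < suc i + (suc i + e)
  i+i<k = s≤s (+-monoʳ-≤ i (≤-trans (n≤1+n i) (m≤m+n (suc i) e)))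
  i<P : i < suc p
  i<P with i <? suc p
  ... | yes i<P = i<P
  ... | no  i≮P = contradiction (subst (_≤ i + i) U+P≡k (+-mono-≤ (≮⇒≥ i≮U) (≮⇒≥ i≮P))) (<⇒≱ i+i<k)

module FoolingWords {m} (I : Subset m) {a b : Letter m}
                    (a∩I : a ∩ I ≡ a) (b∩I : b ∩ I ≡ b) (a≢b : a ≢ b) (i e : ℕ) where

  j k : ℕ
  j = suc i
  k = j + (j + e)

  bit : Fin 2 → Letter m
  bit Fin.zero    = a
  bit (Fin.suc _) = b

  bit-injective : ∀ c c′ → bit c ≡ bit c′ → c ≡ c′
  bit-injective Fin.zero             Fin.zero             _  = refl
  bit-injective Fin.zero             (Fin.suc Fin.zero)   eq = ⊥-elim (a≢b eq)
  bit-injective (Fin.suc Fin.zero)   Fin.zero             eq = ⊥-elim (a≢b (sym eq))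
  bit-injective (Fin.suc Fin.zero)   (Fin.suc Fin.zero)   _  = refl

  code : ∀ {l} → (Fin l → Fin 2) → ℕ → Letter m
  code {zero}  f zero    = b
  code {zero}  f (suc _) = a
  code {suc l} f zero    = bit (f Fin.zero)
  code {suc l} f (suc t) = code (f ∘ Fin.suc) t

  code-∩ : ∀ {l} (f : Fin l → Fin 2) n → code f n ∩ I ≡ code f n
  code-∩ {zero}  f zero    = b∩I
  code-∩ {zero}  f (suc _) = a∩I
  code-∩ {suc l} f zero    with f Fin.zero
  ... | Fin.zero  = a∩I
  ... | Fin.suc _ = b∩I
  code-∩ {suc l} f (suc t) = code-∩ (f ∘ Fin.suc) t

  code-bit : ∀ {l} (f : Fin l → Fin 2) x → code f (toℕ x) ≡ bit (f x)
  code-bit f Fin.zero    = refl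
  code-bit f (Fin.suc x) = code-bit (f ∘ Fin.suc) x

  code-end : ∀ {l} (f : Fin l → Fin 2) → code f l ≡ b
  code-end {zero}  f = refl
  code-end {suc l} f = code-end (f ∘ Fin.suc)

  code-after : ∀ {l} (f : Fin l → Fin 2) n → l < n → code f n ≡ a
  code-after {zero}  f (suc n) _         = refl
  code-after {suc l} f (suc n) (s≤s l<n) = code-after (f ∘ Fin.suc) n l<n

  word : (Fin i → Fin 2) → (Fin i → Fin 2) → List (Letter m)
  word f f′ = applyUpTo (code f) k ++ applyUpTo (code f′) j

  word-∈ : ∀ f → PrefLang k I (word f f)
  word-∈ f = σ , ([] , code f 0 , loop , [] , applyUpTo⁺₂ (code f) k ⊆I ,
                  cong suc (length-applyUpTo (code f ∘ suc) _) , σ-projection) ,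
             IsPrefix-applyUpTo-++⁺ (code f) σ k _ first-period
               (IsPrefix-applyUpTo⁺ (code f) (λ t → σ (k + t)) j second-period)
    where
    loop = applyUpTo (code f ∘ suc) (i + (j + e))
    σ : ωWord m
    σ = cyclic (code f 0) loop
    σ-code : ∀ n → σ n ≡ code f (n % k)
    σ-code = cyclic-applyUpTo (code f) _
    ⊆I : ∀ n → code f n ⊆ I
    ⊆I n = subst (_⊆ I) (code-∩ f n) (p∩q⊆q (code f n) I)
    σ-projection : ∀ n → project I σ n ≡ σ n
    σ-projection n rewrite σ-code n = code-∩ f (n % k)
    first-period : ∀ n → n < k → code f n ≡ σ n
    first-period n n<k = sym (trans (σ-code n) (cong (code f) (m<n⇒m%n≡m n<k)))
    second-period : ∀ t → t < j → code f t ≡ σ (k + t)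
    second-period t t<j = sym (trans (σ-code (k + t)) (cong (code f) k+t%k≡t))
      where
      k+t%k≡t : (k + t) % k ≡ t
      k+t%k≡t = trans (cong (_% k) (+-comm k t))
                      (trans ([m+n]%n≡m%n t k) (m<n⇒m%n≡m (<-≤-trans t<j (m≤m+n j _))))

  lasso-rigid : ∀ f f′ (u : List (Letter m)) v₀ vs → length u + length (v₀ ∷ vs) ≡ k →
                (∀ n → n < k → code f n ≡ lasso u v₀ vs n) →
                (∀ t → t < j → code f′ t ≡ lasso u v₀ vs (k + t)) → f′ ≗ f
  lasso-rigid f f′ [] v₀ vs P≡k first second x = bit-injective _ _ (begin
    bit (f′ x)                         ≡⟨ code-bit f′ x ⟨
    code f′ t                          ≡⟨ second t t<j ⟩
    lasso [] v₀ vs (k + t)             ≡⟨ lasso-wrap [] v₀ vs P≡k t ⟩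
    lasso [] v₀ vs (t % suc (length vs)) ≡⟨ cong (lasso [] v₀ vs) (m<n⇒m%n≡m t<P) ⟩
    lasso [] v₀ vs t                   ≡⟨ first t (<-≤-trans t<j (m≤m+n j _)) ⟨
    code f t                           ≡⟨ code-bit f x ⟩
    bit (f x)                          ∎)
    where
    open ≡-Reasoning
    t = toℕ x
    t<j : t < j
    t<j = m<n⇒m<1+n (toℕ<n x)
    t<P : t < suc (length vs)
    t<P = subst (t <_) (sym P≡k) (<-≤-trans t<j (m≤m+n j _))
  lasso-rigid f f′ u@(_ ∷ _) v₀ vs U+P≡k first second x = ⊥-elim (a≢b (begin
    a                                  ≡⟨ code-after f (U + r) (wrap-position-after-block U _ i e (s≤s z≤n) U+P≡k) ⟨
    code f (U + r)                     ≡⟨ first (U + r) U+r<k ⟩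
    lasso u v₀ vs (U + r)              ≡⟨ lasso-wrap u v₀ vs U+P≡k i ⟨
    lasso u v₀ vs (k + i)              ≡⟨ second i (n<1+n i) ⟨
    code f′ i                          ≡⟨ code-end f′ ⟩
    b                                  ∎))
    where
    open ≡-Reasoning
    U = length u
    r = i % length (v₀ ∷ vs)
    U+r<k : U + r < k
    U+r<k = subst (U + r <_) U+P≡k (+-monoʳ-< U (m%n<n i _))

  word-∉ : ∀ f f′ → PrefLang k I (word f f′) → f′ ≗ f
  word-∉ f f′ (σ , (u , v₀ , vs , _ , _ , U+P≡k , projection) , prefix) =
    lasso-rigid f f′ u v₀ vs U+P≡k
      (λ n n<k → to-lasso (code-∩ f n) (first n n<k))
      (λ t t<j → to-lasso (code-∩ f′ t) (IsPrefix-applyUpTo⁻ (code f′) (λ t → σ (k + t)) j second t t<j))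
    where
    first : ∀ n → n < k → code f n ≡ σ n
    first = proj₁ (IsPrefix-applyUpTo-++⁻ (code f) σ k _ prefix)
    second : IsPrefix (applyUpTo (code f′) j) (λ t → σ (k + t))
    second = proj₂ (IsPrefix-applyUpTo-++⁻ (code f) σ k _ prefix)
    to-lasso : ∀ {x n} → x ∩ I ≡ x → x ≡ σ n → x ≡ lasso u v₀ vs n
    to-lasso {n = n} x∩I x≡σn = trans (sym x∩I) (trans (cong (_∩ I) x≡σn) (projection n))

state-lower-bound : ∀ {m} (I : Subset m) → Nonempty I → ∀ i e (M : NFA (Letter m)) →
                    Recognizes M (PrefLang (suc i + (suc i + e)) I) → 2 ^ i ≤ NFA.n M
state-lower-bound I (x , x∈I) i e M recognizes =
  fooling-set-bound M recognizes (λ z → applyUpTo (code (bits z)) k) (λ z → applyUpTo (code (bits z)) j)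
    (λ z → word-∈ (bits z))
    (λ z z′ z·z′∈L → finToFun-injective {i} {2} (λ y → sym (word-∉ (bits z) (bits z′) z·z′∈L y)))
  where
  bits : Fin (2 ^ i) → Fin i → Fin 2
  bits = finToFun
  ⊥≢I : ⊥ ≢ I
  ⊥≢I ⊥≡I = ∉⊥ (subst (x ∈_) (sym ⊥≡I) x∈I)
  open FoolingWords I (∩-zeroˡ I) (∩-idem I) ⊥≢I i e

length-split : ∀ t → ∃[ i ] ∃[ e ] (4 + t ≡ suc i + (suc i + e) × 4 + t ≤ i * 5)
length-split zero = 1 , 0 , refl , s≤s (s≤s (s≤s (s≤s z≤n)))
length-split (suc zero) = 1 , 1 , refl , ≤-refl
length-split (suc (suc t)) with length-split t
... | i , e , eq , bound = suc i , e , cong (suc ∘ suc) (trans eq (sym (+-suc i (suc i + e)))) ,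
                           +-mono-≤ {2} {5} (s≤s (s≤s z≤n)) bound

theorem3 : ∃[ d ] (1 ≤ d × ∃[ k₀ ] (
    ∀ (k : ℕ) → k₀ ≤ k →
    ∀ (m : ℕ) (I : Subset m) → Nonempty I →
    ∀ (M : NFA (Letter m)) → Recognizes M (PrefLang k I) →
    2 ^ k ≤ NFA.n M ^ d))
theorem3 = 5 , s≤s z≤n , 4 , bound
  where
  bound : ∀ k → 4 ≤ k → ∀ m (I : Subset m) → Nonempty I → ∀ (M : NFA (Letter m)) →
          Recognizes M (PrefLang k I) → 2 ^ k ≤ NFA.n M ^ 5
  bound (suc (suc (suc (suc t)))) (s≤s (s≤s (s≤s (s≤s _)))) m I nonempty M recognizes with length-split t
  ... | i , e , k≡ , k≤5i = begin
    2 ^ (4 + t)    ≤⟨ ^-monoʳ-≤ 2 k≤5i ⟩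
    2 ^ (i * 5)    ≡⟨ ^-*-assoc 2 i 5 ⟨
    (2 ^ i) ^ 5    ≤⟨ ^-monoˡ-≤ 5 (state-lower-bound I nonempty i e M recognizes′) ⟩
    NFA.n M ^ 5    ∎
    where
    open ≤-Reasoning
    recognizes′ : Recognizes M (PrefLang (suc i + (suc i + e)) I)
    recognizes′ = subst (λ k → Recognizes M (PrefLang k I)) k≡ recognizes
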